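{- Let $G$ be a $3$-connected graph with an edge $e=u_1u_2$ such that $G$ has no pair of vertex-disjoint cycles one of which contains $e$. Let $S\subseteq V(G)\setminus\{u_1,u_2\}$ be a set of minimum size such that $S^+:=S\cup\{u_1,u_2\}$ is a vertex-cut of $G$, and suppose $|S|=2$. Suppose that for some connected component $J$ of $G-S^+$ there are edges from both $u_1$ and $u_2$ to $J$. Then for every connected component $K\ne J$ of $G-S^+$, the induced subgraph $G[V(K)\cup S]$ is a path whose endvertices are the two vertices of $S$; moreover, each vertex of $K$ has a neighbor in $\{u_1,u_2\}$.
   Context: Graphs are finite, without loops or parallel edges. -}

module Defs where

open import Data.Nat using (ℕ; _≤_; _<_)
open import Data.Bool using (Bool; true; false; T)
open import Data.Fin using (Fin)
open import Data.Fin.Subset using (Subset; _∈_; _∉_; _∪_; ⁅_⁆; ∣_∣)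
open import Data.List using (List; []; _∷_; _++_; _∷ʳ_; length)
open import Data.List.Membership.Propositional using () renaming (_∈_ to _∈ₗ_)
open import Data.List.Relation.Unary.Linked using (Linked)
open import Data.List.Relation.Unary.Unique.Propositional using (Unique)
open import Data.Product using (Σ; ∃; ∃-syntax; _×_; _,_)
open import Data.Sum using (_⊎_)
open import Data.Empty using (⊥)
open import Relation.Nullary using (¬_)
open import Relation.Binary.PropositionalEquality using (_≡_; _≢_)

record Graph (n : ℕ) : Set where
  field
    adj    : Fin n → Fin n → Bool
    sym    : ∀ x y → adj x y ≡ adj y x
    irrefl : ∀ x → adj x x ≡ false

module _ {n : ℕ} (G : Graph n) where

  Adj : Fin n → Fin n → Set
  Adj x y = T (Graph.adj G x y)

  data Reach (X : Subset n) : Fin n → Fin n → Set where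
    here : ∀ {x} → x ∉ X → Reach X x x
    step : ∀ {x z y} → x ∉ X → Adj x z → Reach X z y → Reach X x y

  ConnectedMinus : Subset n → Set
  ConnectedMinus X = ∀ x y → x ∉ X → y ∉ X → Reach X x y

  KConnected : ℕ → Set
  KConnected k = k < n × (∀ (X : Subset n) → ∣ X ∣ < k → ConnectedMinus X)

  VertexCut : Subset n → Set
  VertexCut X = ∃[ x ] ∃[ y ] (x ∉ X × y ∉ X × ¬ Reach X x y)

  record Cycle : Set where
    field
      first  : Fin n
      rest   : List (Fin n)
      unique : Unique (first ∷ rest)
      long   : 3 ≤ length (first ∷ rest)
      closed : Linked Adj ((first ∷ rest) ∷ʳ first)

  closedWalk : Cycle → List (Fin n)
  closedWalk C = (Cycle.first C ∷ Cycle.rest C) ∷ʳ Cycle.first C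

  OnCycle : Fin n → Cycle → Set
  OnCycle v C = v ∈ₗ (Cycle.first C ∷ Cycle.rest C)

  Consecutive : List (Fin n) → Fin n → Fin n → Set
  Consecutive p x y =
    (∃[ as ] ∃[ bs ] p ≡ as ++ x ∷ y ∷ bs) ⊎ (∃[ as ] ∃[ bs ] p ≡ as ++ y ∷ x ∷ bs)

  CycleContainsEdge : Cycle → Fin n → Fin n → Set
  CycleContainsEdge C x y = Consecutive (closedWalk C) x y

  VertexDisjoint : Cycle → Cycle → Set
  VertexDisjoint C D = ∀ v → OnCycle v C → OnCycle v D → ⊥

  InducedPathBetween : (Fin n → Set) → Fin n → Fin n → Set
  InducedPathBetween W a b =
    Σ (List (Fin n)) λ p →
      Unique p
      × (∀ v → (v ∈ₗ p → W v) × (W v → v ∈ₗ p))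
      × (∃[ mid ] p ≡ (a ∷ mid) ∷ʳ b)
      × (∀ x y → x ∈ₗ p → y ∈ₗ p → (Adj x y → Consecutive p x y) × (Consecutive p x y → Adj x y))

plus : {n : ℕ} → Subset n → Fin n → Fin n → Subset n
plus S u₁ u₂ = S ∪ (⁅ u₁ ⁆ ∪ ⁅ u₂ ⁆)

-- Let K be the component of G − S⁺ containing k. The graph induced on K ∪ S has no cycle:
-- joining u₁ and u₂ through J gives a cycle through e that avoids K ∪ S. Each vertex of S has
-- a neighbour in K, since otherwise the other vertex of S would already give a smaller cut, so
-- the two vertices of S are joined by a path through K. Every vertex of K lies on this path:
-- by minimality of S a vertex off it still reaches J after deleting any one path vertex
-- together with u₁, u₂, so it attaches to the path at two distinct vertices and closes a cycle.
-- Being a path in an acyclic induced subgraph, it is induced. Finally, by 3-connectivity an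
-- interior vertex of the path has a neighbour other than its two path neighbours, and such a
-- neighbour cannot lie in K ∪ S, hence is u₁ or u₂.

module Submission where

open import Defs
open import Data.Nat using (ℕ; suc; _≤_; _<_; _+_; s≤s; z≤n)
open import Data.Nat.Properties using (≤-trans; ≤-reflexive; <-≤-trans; +-monoʳ-≤; +-suc; <⇒≱; suc-injective)
open import Data.Bool using (true; false; T)
open import Data.Fin using (Fin; zero; suc)
open import Data.Fin.Properties using (_≟_; any?)
import Data.Fin.Properties as Fin
open import Data.Fin.Subset using (Subset; _∈_; _∉_; ∣_∣; _∪_; ⁅_⁆; _-_; _─_; ∁)
open import Data.Fin.Subset.Properties
  using (_∈?_; x∈p∧x≢y⇒x∈p-y; x∈p⇒∣p-x∣<∣p∣; p─q⊆p; x∈∁p⇒x∉p; x∉p⇒x∈∁p; ∣p∣≤n; x∉⁅y⁆⇒x≢y;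
         x∈p∪q⁻; x∈p∪q⁺; x∈⁅x⁆; x∈⁅y⁆⇒x≡y; x≢y⇒x∉⁅y⁆; ∣⁅x⁆∣≡1; ∣p∣≤∣x∷p∣)
open import Data.Vec.Base using (here; there; _∷_; [])
open import Data.List using (List; []; _∷_; _++_; _∷ʳ_; length)
open import Data.List.Properties using (∷-injective; ∷-injectiveˡ; ∷ʳ-++; ∷ʳ-injectiveʳ)
open import Data.List.Membership.Propositional using () renaming (_∈_ to _∈ₗ_; _∉_ to _∉ₗ_)
open import Data.List.Membership.Propositional.Properties using (∈-++⁺ˡ; ∈-++⁺ʳ)
import Data.List.Membership.DecPropositional as DecMembership
open import Data.List.Relation.Unary.Any using (here; there)
open import Data.List.Relation.Unary.All using ([])
import Data.List.Relation.Unary.All as All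
import Data.List.Relation.Unary.All.Properties as All
open import Data.List.Relation.Unary.AllPairs using ([]; _∷_)
open import Data.List.Relation.Unary.Linked using (Linked; [-]; _∷_)
open import Data.List.Relation.Unary.Unique.Propositional using (Unique)
open import Data.List.Relation.Unary.Unique.Propositional.Properties using (Unique[x∷xs]⇒x∉xs)
open import Data.Product using (Σ; ∃₂; ∃-syntax; _×_; _,_; proj₁; proj₂)
open import Data.Sum using (_⊎_; inj₁; inj₂; [_,_]′)
import Data.Sum as Sum
open import Data.Empty using (⊥; ⊥-elim)
open import Function using (_∘_)
open import Relation.Nullary using (¬_; ¬?; Dec; yes; no)
open import Relation.Nullary.Decidable using (_×-dec_; T?; decidable-stable)
open import Relation.Unary using (Decidable)
open import Relation.Binary.PropositionalEquality using (_≡_; _≢_; refl; sym; trans; cong; cong₂; subst; subst₂)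

module _ {A : Set} where

  Unique-++⁻ˡ : ∀ xs {ys : List A} → Unique (xs ++ ys) → Unique xs
  Unique-++⁻ˡ []       _         = []
  Unique-++⁻ˡ (_ ∷ xs) (x≢ ∷ u) = All.++⁻ˡ xs x≢ ∷ Unique-++⁻ˡ xs u

  Unique-++⁻ʳ : ∀ xs {ys : List A} → Unique (xs ++ ys) → Unique ys
  Unique-++⁻ʳ []       u       = u
  Unique-++⁻ʳ (_ ∷ xs) (_ ∷ u) = Unique-++⁻ʳ xs u

  Unique-infix : ∀ xs {ys zs : List A} → Unique (xs ++ ys ++ zs) → Unique ys
  Unique-infix xs {ys} u = Unique-++⁻ˡ ys (Unique-++⁻ʳ xs u)

  ∈-infix : ∀ xs {ys zs : List A} {v} → v ∈ₗ ys → v ∈ₗ xs ++ ys ++ zs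
  ∈-infix xs v∈ys = ∈-++⁺ʳ xs (∈-++⁺ˡ v∈ys)

  Unique⇒++-∷-injective : ∀ xs ys {v : A} {zs ws} → Unique (xs ++ v ∷ zs) →
    xs ++ v ∷ zs ≡ ys ++ v ∷ ws → xs ≡ ys × zs ≡ ws
  Unique⇒++-∷-injective []       []       _ refl = refl , refl
  Unique⇒++-∷-injective []       (_ ∷ ys) u refl = ⊥-elim (Unique[x∷xs]⇒x∉xs u (∈-++⁺ʳ ys (here refl)))
  Unique⇒++-∷-injective (_ ∷ xs) []       u refl = ⊥-elim (Unique[x∷xs]⇒x∉xs u (∈-++⁺ʳ xs (here refl)))
  Unique⇒++-∷-injective (x ∷ xs) (y ∷ ys) (_ ∷ u) eq with refl , eq′ ← ∷-injective eq
    with refl , refl ← Unique⇒++-∷-injective xs ys u eq′ = refl , refl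

x∈p─q⇒x∉q : ∀ {m} (p q : Subset m) {x} → x ∈ p ─ q → x ∉ q
x∈p─q⇒x∉q (_ ∷ p) (true ∷ q) () here
x∈p─q⇒x∉q (_ ∷ p) (_ ∷ q) (there x∈) (there x∈q) = x∈p─q⇒x∉q p q x∈ x∈q

∣p∪q∣≤∣p∣+∣q∣ : ∀ {m} (p q : Subset m) → ∣ p ∪ q ∣ ≤ ∣ p ∣ + ∣ q ∣
∣p∪q∣≤∣p∣+∣q∣ [] [] = z≤n
∣p∪q∣≤∣p∣+∣q∣ (true ∷ p) (b ∷ q) = s≤s (≤-trans (∣p∪q∣≤∣p∣+∣q∣ p q) (+-monoʳ-≤ ∣ p ∣ (∣p∣≤∣x∷p∣ b q)))
∣p∪q∣≤∣p∣+∣q∣ (false ∷ p) (true ∷ q) =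
  ≤-trans (s≤s (∣p∪q∣≤∣p∣+∣q∣ p q)) (≤-reflexive (sym (+-suc ∣ p ∣ ∣ q ∣)))
∣p∪q∣≤∣p∣+∣q∣ (false ∷ p) (false ∷ q) = ∣p∪q∣≤∣p∣+∣q∣ p q

∣p∣≡0⇒x∉p : ∀ {m} (p : Subset m) → ∣ p ∣ ≡ 0 → ∀ {x} → x ∉ p
∣p∣≡0⇒x∉p (true ∷ p)  ()
∣p∣≡0⇒x∉p (false ∷ p) eq (there x∈p) = ∣p∣≡0⇒x∉p p eq x∈p

∣p∣≡1⇒singleton : ∀ {m} (p : Subset m) → ∣ p ∣ ≡ 1 → ∃[ s ] (s ∈ p × (∀ {x} → x ∈ p → x ≡ s))
∣p∣≡1⇒singleton (true ∷ p) eq = zero , here , λ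
  { here         → refl
  ; (there x∈p) → ⊥-elim (∣p∣≡0⇒x∉p p (suc-injective eq) x∈p) }
∣p∣≡1⇒singleton (false ∷ p) eq with s , s∈p , only-s ← ∣p∣≡1⇒singleton p eq =
  suc s , there s∈p , λ { (there x∈p) → cong suc (only-s x∈p) }

∣p∣≡2⇒pair : ∀ {m} (p : Subset m) → ∣ p ∣ ≡ 2 →
  ∃₂ λ s₁ s₂ → s₁ ∈ p × s₂ ∈ p × s₁ ≢ s₂ × (∀ {x} → x ∈ p → x ≡ s₁ ⊎ x ≡ s₂)
∣p∣≡2⇒pair (true ∷ p) eq with s , s∈p , only-s ← ∣p∣≡1⇒singleton p (suc-injective eq) =
  zero , suc s , here , there s∈p , (λ ()) , λ
  { here         → inj₁ refl
  ; (there x∈p) → inj₂ (cong suc (only-s x∈p)) }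
∣p∣≡2⇒pair (false ∷ p) eq with s₁ , s₂ , s₁∈p , s₂∈p , s₁≢s₂ , only ← ∣p∣≡2⇒pair p eq =
  suc s₁ , suc s₂ , there s₁∈p , there s₂∈p , s₁≢s₂ ∘ Fin.suc-injective ,
  λ { (there x∈p) → Sum.map (cong suc) (cong suc) (only x∈p) }

module _ {m : ℕ} (S : Subset m) (u₁ u₂ : Fin m) where

  ∈plus⁻ : ∀ {x} → x ∈ plus S u₁ u₂ → x ∈ S ⊎ x ≡ u₁ ⊎ x ≡ u₂
  ∈plus⁻ x∈ with x∈p∪q⁻ S _ x∈
  ... | inj₁ x∈S = inj₁ x∈S
  ... | inj₂ x∈u = inj₂ (Sum.map (x∈⁅y⁆⇒x≡y u₁) (x∈⁅y⁆⇒x≡y u₂) (x∈p∪q⁻ ⁅ u₁ ⁆ ⁅ u₂ ⁆ x∈u))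

  ∈plus⁺ : ∀ {x} → x ∈ S ⊎ x ≡ u₁ ⊎ x ≡ u₂ → x ∈ plus S u₁ u₂
  ∈plus⁺ (inj₁ x∈S)         = x∈p∪q⁺ (inj₁ x∈S)
  ∈plus⁺ (inj₂ (inj₁ refl)) = x∈p∪q⁺ {p = S} (inj₂ (x∈p∪q⁺ (inj₁ (x∈⁅x⁆ u₁))))
  ∈plus⁺ (inj₂ (inj₂ refl)) = x∈p∪q⁺ {p = S} (inj₂ (x∈p∪q⁺ {p = ⁅ u₁ ⁆} (inj₂ (x∈⁅x⁆ u₂))))

  ∉plus⁻ : ∀ {x} → x ∉ plus S u₁ u₂ → x ∉ S × x ≢ u₁ × x ≢ u₂
  ∉plus⁻ x∉ = x∉ ∘ ∈plus⁺ ∘ inj₁ , x∉ ∘ ∈plus⁺ ∘ inj₂ ∘ inj₁ , x∉ ∘ ∈plus⁺ ∘ inj₂ ∘ inj₂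

  ∉plus⁺ : ∀ {x} → x ∉ S → x ≢ u₁ → x ≢ u₂ → x ∉ plus S u₁ u₂
  ∉plus⁺ x∉S x≢u₁ x≢u₂ x∈ with ∈plus⁻ x∈
  ... | inj₁ x∈S         = x∉S x∈S
  ... | inj₂ (inj₁ x≡u₁) = x≢u₁ x≡u₁
  ... | inj₂ (inj₂ x≡u₂) = x≢u₂ x≡u₂

∣⁅x⁆∪⁅y⁆∣≤2 : ∀ {m} (x y : Fin m) → ∣ ⁅ x ⁆ ∪ ⁅ y ⁆ ∣ ≤ 2
∣⁅x⁆∪⁅y⁆∣≤2 x y = ≤-trans (∣p∪q∣≤∣p∣+∣q∣ ⁅ x ⁆ ⁅ y ⁆) (≤-reflexive (cong₂ _+_ (∣⁅x⁆∣≡1 x) (∣⁅x⁆∣≡1 y)))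

x∉⁅y⁆∪⁅z⁆⁺ : ∀ {m} {x y z : Fin m} → x ≢ y → x ≢ z → x ∉ ⁅ y ⁆ ∪ ⁅ z ⁆
x∉⁅y⁆∪⁅z⁆⁺ {y = y} {z} x≢y x≢z x∈ with x∈p∪q⁻ ⁅ y ⁆ ⁅ z ⁆ x∈
... | inj₁ x∈y = x≢y (x∈⁅y⁆⇒x≡y y x∈y)
... | inj₂ x∈z = x≢z (x∈⁅y⁆⇒x≡y z x∈z)

x∉⁅y⁆∪⁅z⁆⁻ : ∀ {m} {x y z : Fin m} → x ∉ ⁅ y ⁆ ∪ ⁅ z ⁆ → x ≢ y × x ≢ z
x∉⁅y⁆∪⁅z⁆⁻ {y = y} x∉ = (λ { refl → x∉ (x∈p∪q⁺ (inj₁ (x∈⁅x⁆ y))) }) ,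
                         (λ { refl → x∉ (x∈p∪q⁺ {p = ⁅ y ⁆} (inj₂ (x∈⁅x⁆ _))) })

module Walks {n : ℕ} (G : Graph n) where

  open DecMembership (_≟_ {n}) using () renaming (_∈?_ to _∈ₗ?_)

  Adj-sym : ∀ {x y} → Adj G x y → Adj G y x
  Adj-sym {x} {y} = subst T (Graph.sym G x y)

  Adj⇒≢ : ∀ {x y} → Adj G x y → x ≢ y
  Adj⇒≢ {x} x~x refl = subst T (Graph.irrefl G x) x~x

  data Walk (P : Fin n → Set) : Fin n → Fin n → Set where
    [_]    : ∀ {x} → P x → Walk P x x
    _∷⟨_⟩_ : ∀ {x z y} → P x → Adj G x z → Walk P z y → Walk P x y

  infixr 5 _∷⟨_⟩_

  module _ {P : Fin n → Set} where

    vertices : ∀ {a b} → Walk P a b → List (Fin n)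
    vertices ([_] {x} _)       = x ∷ []
    vertices (_∷⟨_⟩_ {x} _ _ w) = x ∷ vertices w

    vertex-P : ∀ {a b v} (w : Walk P a b) → v ∈ₗ vertices w → P v
    vertex-P [ p ]        (here refl) = p
    vertex-P (p ∷⟨ _ ⟩ _) (here refl) = p
    vertex-P (_ ∷⟨ _ ⟩ w) (there v∈)  = vertex-P w v∈

    start∈ : ∀ {a b} (w : Walk P a b) → a ∈ₗ vertices w
    start∈ [ _ ]        = here refl
    start∈ (_ ∷⟨ _ ⟩ _) = here refl

    start-P : ∀ {a b} → Walk P a b → P a
    start-P w = vertex-P w (start∈ w)

    end-P : ∀ {a b} → Walk P a b → P b
    end-P [ p ]        = p
    end-P (_ ∷⟨ _ ⟩ w) = end-P w

    end∈ : ∀ {a b} (w : Walk P a b) → b ∈ₗ vertices w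
    end∈ [ _ ]        = here refl
    end∈ (_ ∷⟨ _ ⟩ w) = there (end∈ w)

    vertices-start : ∀ {a b} (w : Walk P a b) → ∃[ t ] vertices w ≡ a ∷ t
    vertices-start [ _ ]        = _ , refl
    vertices-start (_ ∷⟨ _ ⟩ _) = _ , refl

    vertices-end : ∀ {a b} (w : Walk P a b) → ∃[ l ] vertices w ≡ l ∷ʳ b
    vertices-end [ _ ]        = [] , refl
    vertices-end (_ ∷⟨ _ ⟩ w) with l , eq ← vertices-end w = _ ∷ l , cong (_ ∷_) eq

    vertices-ends : ∀ {a b} (w : Walk P a b) → a ≢ b → ∃[ mid ] vertices w ≡ (a ∷ mid) ∷ʳ b
    vertices-ends [ _ ]        a≢a = ⊥-elim (a≢a refl)
    vertices-ends (_ ∷⟨ _ ⟩ w) _   with l , eq ← vertices-end w = l , cong (_ ∷_) eq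

    _++ʷ_ : ∀ {a b c} → Walk P a b → Walk P b c → Walk P a c
    [ _ ]        ++ʷ w′ = w′
    (p ∷⟨ e ⟩ w) ++ʷ w′ = p ∷⟨ e ⟩ (w ++ʷ w′)

    infixr 5 _++ʷ_

    reverse : ∀ {a b} → Walk P a b → Walk P b a
    reverse [ p ]        = [ p ]
    reverse (p ∷⟨ e ⟩ w) = reverse w ++ʷ (start-P w ∷⟨ Adj-sym e ⟩ [ p ])

    suffix : ∀ {a b x} (w : Walk P a b) → x ∈ₗ vertices w →
      Σ (Walk P x b) λ s → ∃[ as ] vertices w ≡ as ++ vertices s
    suffix [ p ]            (here refl) = [ p ] , [] , refl
    suffix w@(_ ∷⟨ _ ⟩ _) (here refl) = w , [] , refl
    suffix (_ ∷⟨ _ ⟩ w) (there x∈) with s , as , eq ← suffix w x∈ = s , _ ∷ as , cong (_ ∷_) eq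

    prefix : ∀ {a b y} (w : Walk P a b) → y ∈ₗ vertices w →
      Σ (Walk P a y) λ s → ∃[ bs ] vertices w ≡ vertices s ++ bs
    prefix [ p ]        (here refl) = [ p ] , [] , refl
    prefix (p ∷⟨ e ⟩ w) (here refl) = [ p ] , vertices w , refl
    prefix (p ∷⟨ e ⟩ w) (there y∈) with s , bs , eq ← prefix w y∈ = p ∷⟨ e ⟩ s , bs , cong (_ ∷_) eq

    Segment : ∀ {a b} → Walk P a b → Fin n → Fin n → Set
    Segment w x y = Σ (Walk P x y) λ s → ∃₂ λ as bs → vertices w ≡ as ++ vertices s ++ bs

    segment : ∀ {a b x y} (w : Walk P a b) → x ∈ₗ vertices w → y ∈ₗ vertices w → x ≢ y →
      Segment w x y ⊎ Segment w y x
    segment [ _ ]        (here refl) (here refl) x≢x = ⊥-elim (x≢x refl)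
    segment w@(_ ∷⟨ _ ⟩ _) (here refl) y∈ _ with s , bs , eq ← prefix w y∈ = inj₁ (s , [] , bs , eq)
    segment w@(_ ∷⟨ _ ⟩ _) (there x∈) (here refl) _ with s , bs , eq ← prefix w (there x∈) =
      inj₂ (s , [] , bs , eq)
    segment (p ∷⟨ e ⟩ w) (there x∈) (there y∈) x≢y =
      Sum.map shift shift (segment w x∈ y∈ x≢y)
      where
      shift : ∀ {x y} → Segment w x y → Segment (p ∷⟨ e ⟩ w) x y
      shift (s , as , bs , eq) = s , _ ∷ as , bs , cong (_ ∷_) eq

    shortcut : ∀ {a b} → Walk P a b → Σ (Walk P a b) (Unique ∘ vertices)
    shortcut [ p ] = [ p ] , [] ∷ []
    shortcut (_∷⟨_⟩_ {x} p e w) with w′ , u ← shortcut w | x ∈ₗ? vertices w′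
    ... | yes x∈ with s , as , eq ← suffix w′ x∈ = s , Unique-++⁻ʳ as (subst Unique eq u)
    ... | no x∉  = p ∷⟨ e ⟩ w′ , All.¬Any⇒All¬ _ x∉ ∷ u

    interior-neighbours : ∀ {a b v} (w : Walk P a b) → v ∈ₗ vertices w → v ≢ a → v ≢ b →
      ∃₂ λ x y → Adj G x v × Adj G v y × ∃₂ λ as bs → vertices w ≡ (as ∷ʳ x) ++ v ∷ y ∷ bs
    interior-neighbours [ _ ]        (here refl) v≢a _ = ⊥-elim (v≢a refl)
    interior-neighbours (_ ∷⟨ _ ⟩ _) (here refl) v≢a _ = ⊥-elim (v≢a refl)
    interior-neighbours {v = v} (_∷⟨_⟩_ {z = c} _ _ w) (there v∈) _ v≢b with v ≟ c
    interior-neighbours (_ ∷⟨ _ ⟩ [ _ ]) _ _ v≢b | yes refl = ⊥-elim (v≢b refl)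
    interior-neighbours (_ ∷⟨ x~v ⟩ (_ ∷⟨ v~y ⟩ w)) _ _ _ | yes refl with t , eq ← vertices-start w =
      _ , _ , x~v , v~y , [] , t , cong (λ l → _ ∷ _ ∷ l) eq
    interior-neighbours (_ ∷⟨ _ ⟩ w) (there v∈) _ v≢b | no v≢c
      with x , y , x~v , v~y , as , bs , eq ← interior-neighbours w v∈ v≢c v≢b =
      x , y , x~v , v~y , _ ∷ as , bs , cong (_ ∷_) eq

    adjacent-at : ∀ {a b x y} (w : Walk P a b) as bs → vertices w ≡ as ++ x ∷ y ∷ bs → Adj G x y
    adjacent-at [ _ ] [] _ ()
    adjacent-at [ _ ] (_ ∷ []) _ ()
    adjacent-at (_ ∷⟨ x~z ⟩ w) [] _ eq
      with refl , eq′ ← ∷-injective eq | t , eq″ ← vertices-start w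
      with refl , _ ← ∷-injective (trans (sym eq″) eq′) = x~z
    adjacent-at (_ ∷⟨ _ ⟩ w) (_ ∷ as) bs eq = adjacent-at w as bs (proj₂ (∷-injective eq))

    Consecutive⇒Adj : ∀ {a b x y} (w : Walk P a b) → Consecutive G (vertices w) x y → Adj G x y
    Consecutive⇒Adj w (inj₁ (as , bs , eq)) = adjacent-at w as bs eq
    Consecutive⇒Adj w (inj₂ (as , bs , eq)) = Adj-sym (adjacent-at w as bs eq)

  mapʷ : ∀ {P Q : Fin n → Set} → (∀ {v} → P v → Q v) → ∀ {a b} → Walk P a b → Walk Q a b
  mapʷ f [ p ]        = [ f p ]
  mapʷ f (p ∷⟨ e ⟩ w) = f p ∷⟨ e ⟩ mapʷ f w

  restrict : ∀ {P Q : Fin n → Set} {a b} (w : Walk P a b) → (∀ {v} → v ∈ₗ vertices w → Q v) →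
    Walk (λ v → P v × Q v) a b
  restrict [ p ]        q = [ p , q (here refl) ]
  restrict (p ∷⟨ e ⟩ w) q = (p , q (here refl)) ∷⟨ e ⟩ restrict w (q ∘ there)

  first-exit : ∀ {P R : Fin n → Set} → Decidable R → ∀ {c d} → Walk P c d → R c → ¬ R d →
    ∃₂ λ r q → Walk (λ v → P v × R v) c r × Adj G r q × P q × ¬ R q
  first-exit R? [ _ ] Rc ¬Rd = ⊥-elim (¬Rd Rc)
  first-exit R? (_∷⟨_⟩_ {x = c} {z = c′} p e w) Rc ¬Rd with R? c′
  ... | no ¬Rc′ = c , c′ , [ p , Rc ] , e , start-P w , ¬Rc′
  ... | yes Rc′ with r , q , h , r~q , Pq , ¬Rq ← first-exit R? w Rc′ ¬Rd =
    r , q , (p , Rc) ∷⟨ e ⟩ h , r~q , Pq , ¬Rq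

  module _ {X : Subset n} where

    Reach⇒Walk : ∀ {a b} → Reach G X a b → Walk (_∉ X) a b
    Reach⇒Walk (here a∉X)       = [ a∉X ]
    Reach⇒Walk (step a∉X e a⇝b) = a∉X ∷⟨ e ⟩ Reach⇒Walk a⇝b

    Walk⇒Reach : ∀ {a b} → Walk (_∉ X) a b → Reach G X a b
    Walk⇒Reach [ a∉X ]        = here a∉X
    Walk⇒Reach (a∉X ∷⟨ e ⟩ w) = step a∉X e (Walk⇒Reach w)

    Reach-sym : ∀ {a b} → Reach G X a b → Reach G X b a
    Reach-sym = Walk⇒Reach ∘ reverse ∘ Reach⇒Walk

    Reach-trans : ∀ {a b c} → Reach G X a b → Reach G X b c → Reach G X a c
    Reach-trans a⇝b b⇝c = Walk⇒Reach (Reach⇒Walk a⇝b ++ʷ Reach⇒Walk b⇝c)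

    Reach-end∉ : ∀ {a b} → Reach G X a b → b ∉ X
    Reach-end∉ = end-P ∘ Reach⇒Walk

    Reach-snoc : ∀ {a b c} → Reach G X a b → Adj G b c → c ∉ X → Reach G X a c
    Reach-snoc a⇝b b~c c∉X = Walk⇒Reach (Reach⇒Walk a⇝b ++ʷ (Reach-end∉ a⇝b ∷⟨ b~c ⟩ [ c∉X ]))

    component-neighbour : ∀ {k a c} → Reach G X k a → Adj G a c → Reach G X k c ⊎ c ∈ X
    component-neighbour {c = c} k⇝a a~c with c ∈? X
    ... | yes c∈X = inj₂ c∈X
    ... | no  c∉X = inj₁ (Reach-snoc k⇝a a~c c∉X)

    within-component : ∀ {o c d} → Reach G X o c → Walk (_∉ X) c d → Walk (Reach G X o) c d
    within-component o⇝c [ _ ]            = [ o⇝c ]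
    within-component o⇝c (_ ∷⟨ c~z ⟩ w) =
      o⇝c ∷⟨ c~z ⟩ within-component (Reach-snoc o⇝c c~z (start-P w)) w

  after-last-visit : ∀ {A : Subset n} {a c b} → Walk (_∈ A) c b → a ≢ b →
    Walk (_∈ A - a) c b ⊎ ∃[ z ] (Adj G a z × Walk (_∈ A - a) z b)
  after-last-visit [ b∈A ] a≢b = inj₁ [ x∈p∧x≢y⇒x∈p-y b∈A (a≢b ∘ sym) ]
  after-last-visit {a = a} (_∷⟨_⟩_ {x = c} c∈A c~z w) a≢b with after-last-visit w a≢b
  ... | inj₂ later = inj₂ later
  ... | inj₁ w′ with c ≟ a
  ...   | yes refl = inj₂ (_ , c~z , w′)
  ...   | no  c≢a  = inj₁ (x∈p∧x≢y⇒x∈p-y c∈A c≢a ∷⟨ c~z ⟩ w′)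

  walk? : ∀ m (A : Subset n) → ∣ A ∣ < m → ∀ a b → Dec (Walk (_∈ A) a b)
  walk? (suc m) A (s≤s ∣A∣≤m) a b with a ∈? A
  ... | no a∉A = no (a∉A ∘ start-P)
  ... | yes a∈A with a ≟ b
  ...   | yes refl = yes [ a∈A ]
  ...   | no a≢b
    with any? (λ z → T? (Graph.adj G a z) ×-dec walk? m (A - a) (<-≤-trans (x∈p⇒∣p-x∣<∣p∣ a∈A) ∣A∣≤m) z b)
  ...     | yes (z , a~z , w) = yes (a∈A ∷⟨ a~z ⟩ mapʷ (p─q⊆p A ⁅ a ⁆) w)
  ...     | no ¬next = no λ w →
    [ (λ w′ → x∈p─q⇒x∉q A ⁅ a ⁆ (start-P w′) (x∈⁅x⁆ a)) , ¬next ]′ (after-last-visit w a≢b)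

  Reach? : ∀ X a b → Dec (Reach G X a b)
  Reach? X a b with walk? (suc n) (∁ X) (s≤s (∣p∣≤n (∁ X))) a b
  ... | yes w = yes (Walk⇒Reach (mapʷ x∈∁p⇒x∉p w))
  ... | no ¬w = no (¬w ∘ mapʷ x∉p⇒x∈∁p ∘ Reach⇒Walk)

  ¬VertexCut⇒ConnectedMinus : ∀ {X} → ¬ VertexCut G X → ConnectedMinus G X
  ¬VertexCut⇒ConnectedMinus {X} ¬cut x y x∉X y∉X =
    decidable-stable (Reach? X x y) (λ x↛y → ¬cut (x , y , x∉X , y∉X , x↛y))

  closeCycle : ∀ {Q : Fin n → Set} {x y z} → Adj G x y → Adj G z x → y ≢ z →
    (w : Walk Q y z) → Unique (vertices w) → (∀ {v} → Q v → v ≢ x) →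
    Σ (Cycle G) λ C → CycleContainsEdge G C x y × (∀ {v} → OnCycle G v C → v ≡ x ⊎ Q v)
  closeCycle {Q} {x} {y} {z} x~y z~x y≢z w u Q⇒≢x = C , contains-edge w y≢z , on-cycle
    where
    long : ∀ {y z} (w : Walk Q y z) → y ≢ z → 2 ≤ length (vertices w)
    long [ _ ]        y≢y = ⊥-elim (y≢y refl)
    long (_ ∷⟨ _ ⟩ w) _ with vertices w | vertices-start w
    ... | _ | _ , refl = s≤s (s≤s z≤n)

    linked : ∀ {c a b d} → Adj G c a → (w : Walk Q a b) → Adj G b d → Linked (Adj G) (c ∷ (vertices w ∷ʳ d))
    linked c~a [ _ ]          b~d = c~a ∷ b~d ∷ [-]
    linked c~a (_ ∷⟨ e ⟩ w) b~d = c~a ∷ linked e w b~d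

    C : Cycle G
    C = record
      { first  = x
      ; rest   = vertices w
      ; unique = All.¬Any⇒All¬ _ (λ x∈w → Q⇒≢x (vertex-P w x∈w) refl) ∷ u
      ; long   = s≤s (long w y≢z)
      ; closed = linked x~y w z~x
      }

    contains-edge : (w : Walk Q y z) → y ≢ z → Consecutive G ((x ∷ vertices w) ∷ʳ x) x y
    contains-edge [ _ ]        y≢y = ⊥-elim (y≢y refl)
    contains-edge (_ ∷⟨ _ ⟩ _) _   = inj₁ ([] , _ , refl)

    on-cycle : ∀ {v} → OnCycle G v C → v ≡ x ⊎ Q v
    on-cycle (here v≡x) = inj₁ v≡x
    on-cycle (there v∈w) = inj₂ (vertex-P w v∈w)

  cycle-through-component : ∀ {X u₁ u₂ j a b} → u₁ ∈ X → u₂ ∈ X → Adj G u₁ u₂ →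
    Reach G X j a → Adj G u₁ a → Reach G X j b → Adj G u₂ b →
    Σ (Cycle G) λ C → CycleContainsEdge G C u₁ u₂ ×
      (∀ {v} → OnCycle G v C → v ≡ u₁ ⊎ v ≡ u₂ ⊎ Reach G X j v)
  cycle-through-component {X} {u₁} {u₂} {j} u₁∈X u₂∈X u₁~u₂ j⇝a u₁~a j⇝b u₂~b =
    closeCycle u₁~u₂ (Adj-sym u₁~a) (λ { refl → Reach-end∉ j⇝a u₂∈X }) (proj₁ path) (proj₂ path) ≢u₁
    where
    path : Σ (Walk (λ v → v ≡ u₂ ⊎ Reach G X j v) u₂ _) (Unique ∘ vertices)
    path = shortcut (inj₁ refl ∷⟨ u₂~b ⟩ mapʷ inj₂ (within-component j⇝b b⇝a))
      where b⇝a = Reach⇒Walk (Reach-trans (Reach-sym j⇝b) j⇝a)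

    ≢u₁ : ∀ {v} → v ≡ u₂ ⊎ Reach G X j v → v ≢ u₁
    ≢u₁ (inj₁ refl) = Adj⇒≢ u₁~u₂ ∘ sym
    ≢u₁ (inj₂ j⇝v) refl = Reach-end∉ j⇝v u₁∈X

  first-step : ∀ {Z a b} → Reach G Z a b → a ≢ b → ∃[ z ] (Adj G a z × z ∉ Z)
  first-step (here _)        a≢a = ⊥-elim (a≢a refl)
  first-step (step _ a~z z⇝b) _   = _ , a~z , start-P (Reach⇒Walk z⇝b)

  Consecutive-interior : ∀ as {x v y z bs} → Unique ((as ∷ʳ x) ++ v ∷ y ∷ bs) →
    Consecutive G ((as ∷ʳ x) ++ v ∷ y ∷ bs) v z → z ≡ x ⊎ z ≡ y
  Consecutive-interior as {x} u (inj₁ (cs , _ , eq)) =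
    inj₂ (sym (∷-injectiveˡ (proj₂ (Unique⇒++-∷-injective (as ∷ʳ x) cs u eq))))
  Consecutive-interior as {x} {z = z} u (inj₂ (cs , _ , eq)) =
    inj₁ (sym (∷ʳ-injectiveʳ as cs
      (proj₁ (Unique⇒++-∷-injective (as ∷ʳ x) (cs ∷ʳ z) u (trans eq (sym (∷ʳ-++ cs z _)))))))

module CycleFree {n : ℕ} (G : Graph n) (T : Fin n → Set)
  (cycle-free : ∀ (C : Cycle G) → (∀ {v} → OnCycle G v C → T v) → ⊥) where

  open Walks G

  no-closing-edge : ∀ {x y z} → T x → Adj G x y → Adj G z x → y ≢ z →
    Walk (λ v → T v × v ≢ x) y z → ⊥
  no-closing-edge Tx x~y z~x y≢z w with w′ , u ← shortcut w
    with C , _ , on-C ← closeCycle x~y z~x y≢z w′ u proj₂ =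
    cycle-free C λ v∈C → [ (λ { refl → Tx }) , proj₁ ]′ (on-C v∈C)

  adjacent-ends : ∀ {x y} (s : Walk T x y) → Unique (vertices s) → Adj G x y → vertices s ≡ x ∷ y ∷ []
  adjacent-ends [ _ ]              _ x~x = ⊥-elim (Adj⇒≢ x~x refl)
  adjacent-ends (_ ∷⟨ _ ⟩ [ _ ])  _ _   = refl
  adjacent-ends (Tx ∷⟨ x~c ⟩ s@(_ ∷⟨ _ ⟩ s′)) (x∉s ∷ c∉s′ ∷ _) x~y =
    ⊥-elim (no-closing-edge Tx x~c (Adj-sym x~y) (All.lookup c∉s′ (end∈ s′))
      (restrict s λ v∈s v≡x → All.lookup x∉s v∈s (sym v≡x)))

  module _ {a b} (p : Walk T a b) (p-unique : Unique (vertices p)) where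

    private
      segment-unique : ∀ {x y} ((s , as , _) : Segment p x y) → Unique (vertices s)
      segment-unique (s , as , _ , eq) = Unique-infix as (subst Unique eq p-unique)

      segment⊆ : ∀ {x y v} ((s , _) : Segment p x y) → v ∈ₗ vertices s → v ∈ₗ vertices p
      segment⊆ {v = v} (s , as , _ , eq) v∈s = subst (v ∈ₗ_) (sym eq) (∈-infix as v∈s)

      adjacent-segment : ∀ {x y} → Segment p x y → Adj G x y → ∃₂ λ as bs → vertices p ≡ as ++ x ∷ y ∷ bs
      adjacent-segment seg@(s , as , bs , eq) x~y =
        as , bs , trans eq (cong (λ l → as ++ l ++ bs) (adjacent-ends s (segment-unique seg) x~y))

    Adj⇒Consecutive : ∀ {x y} → x ∈ₗ vertices p → y ∈ₗ vertices p → Adj G x y →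
      Consecutive G (vertices p) x y
    Adj⇒Consecutive x∈p y∈p x~y with segment p x∈p y∈p (Adj⇒≢ x~y)
    ... | inj₁ seg = inj₁ (adjacent-segment seg x~y)
    ... | inj₂ seg = inj₂ (adjacent-segment seg (Adj-sym x~y))

    OffPath : Fin n → Set
    OffPath v = T v × v ∉ₗ vertices p

    private
      attached-segment : ∀ {w r₁ r₂ q₁ q₂} → Segment p q₁ q₂ → q₁ ≢ q₂ →
        Walk OffPath w r₁ → Adj G r₁ q₁ → Walk OffPath w r₂ → Adj G r₂ q₂ → ⊥
      attached-segment ([ _ ] , _) q₁≢q₁ _ _ _ _ = q₁≢q₁ refl
      attached-segment {q₁ = q₁} seg@(Tq₁ ∷⟨ q₁~c ⟩ s , _) q₁≢q₂ h₁ r₁~q₁ h₂ r₂~q₂ =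
        no-closing-edge Tq₁ q₁~c r₁~q₁ (λ { refl → proj₂ (end-P h₁) (segment⊆ seg (there (start∈ s))) })
          (restrict s s≢q₁ ++ʷ (end-P s , q₁≢q₂ ∘ sym) ∷⟨ Adj-sym r₂~q₂ ⟩
             (mapʷ off (reverse h₂) ++ʷ mapʷ off h₁))
        where
        s≢q₁ : ∀ {v} → v ∈ₗ vertices s → v ≢ q₁
        s≢q₁ v∈s v≡q₁ with q₁∉s ∷ _ ← segment-unique seg = All.lookup q₁∉s v∈s (sym v≡q₁)

        off : ∀ {v} → OffPath v → T v × v ≢ q₁
        off (Tv , v∉p) = Tv , λ { refl → v∉p (segment⊆ seg (here refl)) }

    no-two-attachments : ∀ {w r₁ r₂ q₁ q₂} → q₁ ∈ₗ vertices p → q₂ ∈ₗ vertices p → q₁ ≢ q₂ →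
      Walk OffPath w r₁ → Adj G r₁ q₁ → Walk OffPath w r₂ → Adj G r₂ q₂ → ⊥
    no-two-attachments q₁∈p q₂∈p q₁≢q₂ h₁ r₁~q₁ h₂ r₂~q₂ with segment p q₁∈p q₂∈p q₁≢q₂
    ... | inj₁ seg = attached-segment seg q₁≢q₂ h₁ r₁~q₁ h₂ r₂~q₂
    ... | inj₂ seg = attached-segment seg (q₁≢q₂ ∘ sym) h₂ r₂~q₂ h₁ r₁~q₁

module Setting {n : ℕ} (G : Graph n) (u₁ u₂ : Fin n) (u₁~u₂ : Adj G u₁ u₂)
  (no-disjoint-cycles : ¬ (Σ (Cycle G) λ C → Σ (Cycle G) λ D →
                             CycleContainsEdge G C u₁ u₂ × VertexDisjoint G C D))
  (S : Subset n) (u₁∉S : u₁ ∉ S) (u₂∉S : u₂ ∉ S)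
  {s₁ s₂ : Fin n} (s₁∈S : s₁ ∈ S) (s₂∈S : s₂ ∈ S) (s₁≢s₂ : s₁ ≢ s₂)
  (S⊆s₁s₂ : ∀ {v} → v ∈ S → v ≡ s₁ ⊎ v ≡ s₂)
  (removing-pair : ∀ x y → ConnectedMinus G (⁅ x ⁆ ∪ ⁅ y ⁆))
  (removing-one : ∀ q → q ≢ u₁ → q ≢ u₂ → ConnectedMinus G (plus ⁅ q ⁆ u₁ u₂))
  {j a b : Fin n} (j⇝a : Reach G (plus S u₁ u₂) j a) (u₁~a : Adj G u₁ a)
  (j⇝b : Reach G (plus S u₁ u₂) j b) (u₂~b : Adj G u₂ b)
  {k : Fin n} (k∉X : k ∉ plus S u₁ u₂) (k↛j : ¬ Reach G (plus S u₁ u₂) k j) where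

  open Walks G
  open DecMembership (_≟_ {n}) using () renaming (_∈?_ to _∈ₗ?_)

  X : Subset n
  X = plus S u₁ u₂

  K : Fin n → Set
  K = Reach G X k

  K∪S : Fin n → Set
  K∪S v = K v ⊎ v ∈ S

  j∉X : j ∉ X
  j∉X = start-P (Reach⇒Walk j⇝a)

  S⊆X : ∀ {v} → v ∈ S → v ∈ X
  S⊆X v∈S = ∈plus⁺ S u₁ u₂ (inj₁ v∈S)

  u₁∈X : u₁ ∈ X
  u₁∈X = ∈plus⁺ S u₁ u₂ (inj₂ (inj₁ refl))

  u₂∈X : u₂ ∈ X
  u₂∈X = ∈plus⁺ S u₁ u₂ (inj₂ (inj₂ refl))

  K∪S⇒≢u₁ : ∀ {v} → K∪S v → v ≢ u₁
  K∪S⇒≢u₁ (inj₁ k⇝v) refl = Reach-end∉ k⇝v u₁∈X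
  K∪S⇒≢u₁ (inj₂ v∈S) refl = u₁∉S v∈S

  K∪S⇒≢u₂ : ∀ {v} → K∪S v → v ≢ u₂
  K∪S⇒≢u₂ (inj₁ k⇝v) refl = Reach-end∉ k⇝v u₂∈X
  K∪S⇒≢u₂ (inj₂ v∈S) refl = u₂∉S v∈S

  K-disjoint-S : ∀ {v s} → K v → s ∈ S → v ≢ s
  K-disjoint-S k⇝v s∈S refl = Reach-end∉ k⇝v (S⊆X s∈S)

  j∉K∪S : ¬ K∪S j
  j∉K∪S (inj₁ k⇝j) = k↛j k⇝j
  j∉K∪S (inj₂ j∈S) = j∉X (S⊆X j∈S)

  K∪S⇒≢j : ∀ {v} → K∪S v → v ≢ j
  K∪S⇒≢j v∈K∪S refl = j∉K∪S v∈K∪S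

  K∪S-neighbour : ∀ {v z} → K v → Adj G v z → z ≢ u₁ → z ≢ u₂ → K∪S z
  K∪S-neighbour k⇝v v~z z≢u₁ z≢u₂ with component-neighbour k⇝v v~z
  ... | inj₁ k⇝z = inj₁ k⇝z
  ... | inj₂ z∈X with ∈plus⁻ S u₁ u₂ z∈X
  ...   | inj₁ z∈S         = inj₂ z∈S
  ...   | inj₂ (inj₁ z≡u₁) = ⊥-elim (z≢u₁ z≡u₁)
  ...   | inj₂ (inj₂ z≡u₂) = ⊥-elim (z≢u₂ z≡u₂)

  private
    cycle-through-J-avoids-K∪S : ∀ {v} → v ≡ u₁ ⊎ v ≡ u₂ ⊎ Reach G X j v → ¬ K∪S v
    cycle-through-J-avoids-K∪S (inj₁ refl)        v∈K∪S      = K∪S⇒≢u₁ v∈K∪S refl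
    cycle-through-J-avoids-K∪S (inj₂ (inj₁ refl)) v∈K∪S      = K∪S⇒≢u₂ v∈K∪S refl
    cycle-through-J-avoids-K∪S (inj₂ (inj₂ j⇝v)) (inj₁ k⇝v) = k↛j (Reach-trans k⇝v (Reach-sym j⇝v))
    cycle-through-J-avoids-K∪S (inj₂ (inj₂ j⇝v)) (inj₂ v∈S) = Reach-end∉ j⇝v (S⊆X v∈S)

  K∪S-cycle-free : ∀ (D : Cycle G) → (∀ {v} → OnCycle G v D → K∪S v) → ⊥
  K∪S-cycle-free D D⊆K∪S with C , C∋e , C⊆ ← cycle-through-component u₁∈X u₂∈X u₁~u₂ j⇝a u₁~a j⇝b u₂~b =
    no-disjoint-cycles (C , D , C∋e , λ v v∈C v∈D → cycle-through-J-avoids-K∪S (C⊆ v∈C) (D⊆K∪S v∈D))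

  open CycleFree G K∪S K∪S-cycle-free

  Avoiding : Fin n → Fin n → Set
  Avoiding q v = v ≢ q × v ≢ u₁ × v ≢ u₂

  walk-to-j-avoiding : ∀ q {w} → K∪S q → K w → w ≢ q → Walk (Avoiding q) w j
  walk-to-j-avoiding q q∈K∪S k⇝w w≢q =
    mapʷ avoiding (Reach⇒Walk (removing-one q (K∪S⇒≢u₁ q∈K∪S) (K∪S⇒≢u₂ q∈K∪S) _ j
      (outside (Reach-end∉ k⇝w) w≢q) (outside j∉X (K∪S⇒≢j q∈K∪S ∘ sym))))
    where
    outside : ∀ {v} → v ∉ X → v ≢ q → v ∉ plus ⁅ q ⁆ u₁ u₂
    outside v∉X v≢q with _ , v≢u₁ , v≢u₂ ← ∉plus⁻ S u₁ u₂ v∉X =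
      ∉plus⁺ ⁅ q ⁆ u₁ u₂ (x≢y⇒x∉⁅y⁆ v≢q) v≢u₁ v≢u₂

    avoiding : ∀ {v} → v ∉ plus ⁅ q ⁆ u₁ u₂ → Avoiding q v
    avoiding v∉ with v∉q , v≢u₁ , v≢u₂ ← ∉plus⁻ ⁅ q ⁆ u₁ u₂ v∉ = x∉⁅y⁆⇒x≢y v∉q , v≢u₁ , v≢u₂

  K-neighbour : ∀ {s s′} → s′ ∈ S → (∀ {v} → v ∈ S → v ≡ s ⊎ v ≡ s′) → ∃[ c ] (K c × Adj G c s)
  K-neighbour s′∈S S⊆ss′
    with first-exit (Reach? X k) (walk-to-j-avoiding _ (inj₂ s′∈S) (here k∉X) (K-disjoint-S (here k∉X) s′∈S))
                    (here k∉X) k↛j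
  ... | r , q , h , r~q , (q≢s′ , q≢u₁ , q≢u₂) , ¬Kq with K∪S-neighbour (proj₂ (end-P h)) r~q q≢u₁ q≢u₂
  ...   | inj₁ Kq = ⊥-elim (¬Kq Kq)
  ...   | inj₂ q∈S with S⊆ss′ q∈S
  ...     | inj₁ refl = r , proj₂ (end-P h) , r~q
  ...     | inj₂ q≡s′ = ⊥-elim (q≢s′ q≡s′)

  spine-walk : Walk K∪S s₁ s₂
  spine-walk with c₁ , k⇝c₁ , c₁~s₁ ← K-neighbour s₂∈S S⊆s₁s₂
                | c₂ , k⇝c₂ , c₂~s₂ ← K-neighbour s₁∈S (Sum.swap ∘ S⊆s₁s₂) =
    inj₂ s₁∈S ∷⟨ Adj-sym c₁~s₁ ⟩
      (mapʷ inj₁ (within-component k⇝c₁ (Reach⇒Walk (Reach-trans (Reach-sym k⇝c₁) k⇝c₂)))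
        ++ʷ inj₁ k⇝c₂ ∷⟨ c₂~s₂ ⟩ [ inj₂ s₂∈S ])

  opaque
    spine : Walk K∪S s₁ s₂
    spine = proj₁ (shortcut spine-walk)

    spine-unique : Unique (vertices spine)
    spine-unique = proj₂ (shortcut spine-walk)

  S⊆spine : ∀ {v} → v ∈ S → v ∈ₗ vertices spine
  S⊆spine v∈S with S⊆s₁s₂ v∈S
  ... | inj₁ refl = start∈ spine
  ... | inj₂ refl = end∈ spine

  private
    OffSpineK : Fin n → Set
    OffSpineK v = K v × v ∉ₗ vertices spine

    exit-lands-on-spine : ∀ {r q} → K r → Adj G r q → q ≢ u₁ → q ≢ u₂ → ¬ OffSpineK q →
      q ∈ₗ vertices spine
    exit-lands-on-spine k⇝r r~q q≢u₁ q≢u₂ ¬off with K∪S-neighbour k⇝r r~q q≢u₁ q≢u₂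
    ... | inj₂ q∈S = S⊆spine q∈S
    ... | inj₁ k⇝q with _ ∈ₗ? vertices spine
    ...   | yes q∈p = q∈p
    ...   | no  q∉p = ⊥-elim (¬off (k⇝q , q∉p))

  Attachment : Fin n → Fin n → Set
  Attachment w q = q ∈ₗ vertices spine × ∃[ r ] (Walk (OffPath spine spine-unique) w r × Adj G r q)

  attachment-avoiding : ∀ {w q} → K w → w ∉ₗ vertices spine → q ∈ₗ vertices spine →
    ∃[ q′ ] (q′ ≢ q × Attachment w q′)
  attachment-avoiding k⇝w w∉p q∈p
    with first-exit (λ v → Reach? X k v ×-dec ¬? (v ∈ₗ? vertices spine))
              (walk-to-j-avoiding _ (vertex-P spine q∈p) k⇝w (λ { refl → w∉p q∈p }))
              (k⇝w , w∉p) (j∉K∪S ∘ inj₁ ∘ proj₁)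
  ... | r , q′ , h , r~q′ , (q′≢q , q′≢u₁ , q′≢u₂) , ¬off =
    q′ , q′≢q , exit-lands-on-spine (proj₁ (proj₂ (end-P h))) r~q′ q′≢u₁ q′≢u₂ ¬off ,
    r , mapʷ (λ (_ , k⇝v , v∉p) → inj₁ k⇝v , v∉p) h , r~q′

  K⊆spine : ∀ {w} → K w → w ∈ₗ vertices spine
  K⊆spine {w} k⇝w with w ∈ₗ? vertices spine
  ... | yes w∈p = w∈p
  ... | no  w∉p
    with q₁ , _ , q₁∈p , _ , h₁ , r₁~q₁ ← attachment-avoiding k⇝w w∉p (start∈ spine)
    with q₂ , q₂≢q₁ , q₂∈p , _ , h₂ , r₂~q₂ ← attachment-avoiding k⇝w w∉p q₁∈p =
    ⊥-elim (no-two-attachments spine spine-unique q₁∈p q₂∈p (q₂≢q₁ ∘ sym) h₁ r₁~q₁ h₂ r₂~q₂)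

  K∪S⊆spine : ∀ {v} → K∪S v → v ∈ₗ vertices spine
  K∪S⊆spine (inj₁ k⇝v) = K⊆spine k⇝v
  K∪S⊆spine (inj₂ v∈S) = S⊆spine v∈S

  spine-induced : InducedPathBetween G K∪S s₁ s₂
  spine-induced =
    vertices spine , spine-unique , (λ v → vertex-P spine , K∪S⊆spine) , vertices-ends spine s₁≢s₂ ,
    λ x y x∈p y∈p → Adj⇒Consecutive spine spine-unique x∈p y∈p , Consecutive⇒Adj spine

  neighbour-avoiding : ∀ {v x y} → K v → v ≢ x → v ≢ y → K∪S x → K∪S y →
    ∃[ z ] (Adj G v z × z ≢ x × z ≢ y)
  neighbour-avoiding {v} {x} {y} k⇝v v≢x v≢y x∈K∪S y∈K∪S =
    let z , v~z , z∉xy = first-step v⇝j (K∪S⇒≢j (inj₁ k⇝v)) in z , v~z , x∉⁅y⁆∪⁅z⁆⁻ z∉xy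
    where
    v⇝j : Reach G (⁅ x ⁆ ∪ ⁅ y ⁆) v j
    v⇝j = removing-pair x y v j (x∉⁅y⁆∪⁅z⁆⁺ v≢x v≢y)
            (x∉⁅y⁆∪⁅z⁆⁺ (K∪S⇒≢j x∈K∪S ∘ sym) (K∪S⇒≢j y∈K∪S ∘ sym))

  K-adjacent-to-u : ∀ v → K v → Adj G v u₁ ⊎ Adj G v u₂
  K-adjacent-to-u v k⇝v
    with x , y , x~v , v~y , as , bs , eq ←
           interior-neighbours spine (K⊆spine k⇝v) (K-disjoint-S k⇝v s₁∈S) (K-disjoint-S k⇝v s₂∈S)
    with z , v~z , z≢x , z≢y ←
           neighbour-avoiding k⇝v (Adj⇒≢ x~v ∘ sym) (Adj⇒≢ v~y)
             (vertex-P spine (subst (x ∈ₗ_) (sym eq) (∈-++⁺ˡ (∈-++⁺ʳ as (here refl)))))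
             (vertex-P spine (subst (y ∈ₗ_) (sym eq) (∈-++⁺ʳ (as ∷ʳ x) (there (here refl)))))
    with z ≟ u₁ | z ≟ u₂
  ... | yes refl | _        = inj₁ v~z
  ... | no _     | yes refl = inj₂ v~z
  ... | no z≢u₁  | no z≢u₂  = ⊥-elim ([ z≢x , z≢y ]′ (Consecutive-interior as unique consecutive))
    where
    unique : Unique ((as ∷ʳ x) ++ v ∷ y ∷ bs)
    unique = subst Unique eq spine-unique

    consecutive : Consecutive G ((as ∷ʳ x) ++ v ∷ y ∷ bs) v z
    consecutive = subst (λ l → Consecutive G l v z) eq
      (Adj⇒Consecutive spine spine-unique (K⊆spine k⇝v) (K∪S⊆spine (K∪S-neighbour k⇝v v~z z≢u₁ z≢u₂)) v~z)

lemma2p9 : {n : ℕ} (G : Graph n) (u₁ u₂ : Fin n) →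
  KConnected G 3 →
  Adj G u₁ u₂ →
  ¬ (Σ (Cycle G) λ C → Σ (Cycle G) λ D → CycleContainsEdge G C u₁ u₂ × VertexDisjoint G C D) →
  (S : Subset n) → u₁ ∉ S → u₂ ∉ S →
  VertexCut G (plus S u₁ u₂) →
  (∀ (S′ : Subset n) → u₁ ∉ S′ → u₂ ∉ S′ → VertexCut G (plus S′ u₁ u₂) → ∣ S ∣ ≤ ∣ S′ ∣) →
  ∣ S ∣ ≡ 2 →
  (j : Fin n) → j ∉ plus S u₁ u₂ →
  (∃[ a ] (Reach G (plus S u₁ u₂) j a × Adj G u₁ a)) →
  (∃[ b ] (Reach G (plus S u₁ u₂) j b × Adj G u₂ b)) →
  (k : Fin n) → k ∉ plus S u₁ u₂ → ¬ Reach G (plus S u₁ u₂) j k →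
  (∃[ s₁ ] ∃[ s₂ ] (s₁ ∈ S × s₂ ∈ S × s₁ ≢ s₂ ×
      InducedPathBetween G (λ v → Reach G (plus S u₁ u₂) k v ⊎ v ∈ S) s₁ s₂))
  × (∀ v → Reach G (plus S u₁ u₂) k v → Adj G v u₁ ⊎ Adj G v u₂)
lemma2p9 G u₁ u₂ (_ , small-sets-not-cuts) u₁~u₂ no-disjoint-cycles S u₁∉S u₂∉S _ minimal ∣S∣≡2
         j _ (_ , j⇝a , u₁~a) (_ , j⇝b , u₂~b) k k∉X j↛k
  with s₁ , s₂ , s₁∈S , s₂∈S , s₁≢s₂ , S⊆s₁s₂ ← ∣p∣≡2⇒pair S ∣S∣≡2 =
  (s₁ , s₂ , s₁∈S , s₂∈S , s₁≢s₂ , spine-induced) , K-adjacent-to-u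
  where
  open Walks G using (Reach-sym; ¬VertexCut⇒ConnectedMinus)

  removing-pair : ∀ x y → ConnectedMinus G (⁅ x ⁆ ∪ ⁅ y ⁆)
  removing-pair x y = small-sets-not-cuts _ (s≤s (∣⁅x⁆∪⁅y⁆∣≤2 x y))

  removing-one : ∀ q → q ≢ u₁ → q ≢ u₂ → ConnectedMinus G (plus ⁅ q ⁆ u₁ u₂)
  removing-one q q≢u₁ q≢u₂ = ¬VertexCut⇒ConnectedMinus λ cut →
    <⇒≱ (s≤s (s≤s z≤n)) (subst₂ _≤_ ∣S∣≡2 (∣⁅x⁆∣≡1 q)
      (minimal ⁅ q ⁆ (x≢y⇒x∉⁅y⁆ (q≢u₁ ∘ sym)) (x≢y⇒x∉⁅y⁆ (q≢u₂ ∘ sym)) cut))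

  open Setting G u₁ u₂ u₁~u₂ no-disjoint-cycles S u₁∉S u₂∉S s₁∈S s₂∈S s₁≢s₂ S⊆s₁s₂
    removing-pair removing-one j⇝a u₁~a j⇝b u₂~b k∉X (j↛k ∘ Reach-sym)
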